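{- Let $0 < \epsilon \leq \frac{1}{2}$ and let $D$ be the discriminant of a real quadratic field such that there exists an odd prime $p$ with Legendre symbol $\left(\frac{D}{p}\right) = 1$ and $\frac{1}{2}\sqrt{D} \leq p \leq \left(\frac{1}{2} + \epsilon\right)\sqrt{D}$. Then the real quadratic field $\mathbf{Q}(\sqrt{D})$ has a generator $\alpha$ (i.e. $\mathbf{Q}(\alpha) = \mathbf{Q}(\sqrt{D})$) with $$H(\alpha) \leq \left(\frac{1}{2} + \epsilon\right)\sqrt{D}.$$
   Context: For an algebraic number $\alpha$ with minimal polynomial $f = a_n x^n + \dots + a_0$ over $\mathbf{Q}$ normalized so that $a_i \in \mathbf{Z}$ and $\gcd(a_0,\dots,a_n)=1$, the height is $H(\alpha) = \max(|a_0|,\dots,|a_n|)$.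
   Formalization: The parameter ε ranges over the rationals. -}

module Defs where

open import Data.Nat as ℕ using (ℕ; zero; suc; _%_; _≡ᵇ_; _⊔_)
open import Data.Nat.Divisibility using (_∣_)
open import Data.Nat.GCD using (gcd)
open import Data.Integer as ℤ using (ℤ; +_; ∣_∣; 0ℤ; 1ℤ; -1ℤ)
open import Data.Rational as ℚ using (ℚ; 0ℚ; 1ℚ)
open import Data.List using (List; []; _∷_; _∷ʳ_; foldr; map; upTo; length)
open import Data.Bool.ListAction using (any)
open import Data.List.Relation.Unary.All using (All)
open import Data.Bool using (if_then_else_)
open import Data.Product using (Σ; ∃; _×_)
open import Data.Sum using (_⊎_)
open import Relation.Binary.PropositionalEquality using (_≡_; _≢_)

SquareFree : ℕ → Set
SquareFree m = ∀ (k : ℕ) → (k ℕ.* k) ∣ m → k ≡ 1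

IsRealQuadDisc : ℕ → Set
IsRealQuadDisc D =
  (1 ℕ.< D) ×
  ((D % 4 ≡ 1 × SquareFree D)
   ⊎ (Σ ℕ λ m → D ≡ 4 ℕ.* m × (m % 4 ≡ 2 ⊎ m % 4 ≡ 3) × SquareFree m))

legendre : ℕ → ℕ → ℤ
legendre D zero = 0ℤ
legendre D (suc k) =
  if D % suc k ≡ᵇ 0 then 0ℤ
  else if any (λ x → (x ℕ.* x) % suc k ≡ᵇ D % suc k) (upTo (suc k)) then 1ℤ
  else -1ℤ

record QF : Set where
  constructor _+_√D
  field
    re : ℚ
    im : ℚ

ℕ→ℚ : ℕ → ℚ
ℕ→ℚ n = + n ℚ./ 1

ℤ→ℚ : ℤ → ℚ
ℤ→ℚ z = z ℚ./ 1

module _ (D : ℕ) where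

  addQF : QF → QF → QF
  addQF (a + b √D) (c + d √D) = (a ℚ.+ c) + (b ℚ.+ d) √D

  mulQF : QF → QF → QF
  mulQF (a + b √D) (c + d √D) =
    (a ℚ.* c ℚ.+ ℕ→ℚ D ℚ.* (b ℚ.* d)) + (a ℚ.* d ℚ.+ b ℚ.* c) √D

  scalar : ℚ → QF
  scalar q = q + 0ℚ √D

  zeroQF : QF
  zeroQF = 0ℚ + 0ℚ √D

  sqrtD : QF
  sqrtD = 0ℚ + 1ℚ √D

  -- evaluation of a polynomial with rational coefficients [c₀, c₁, …, cₙ]
  -- (lowest degree first) at an element of Q(√D), by Horner's rule
  eval : List ℚ → QF → QF
  eval [] x = zeroQF
  eval (c ∷ cs) x = addQF (scalar c) (mulQF x (eval cs x))

  -- α generates Q(√D): Q(α) = Q[α] contains √D (Q(α) ⊆ Q(√D) holds anyway)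
  Generates : QF → Set
  Generates α = Σ (List ℚ) λ g → eval g α ≡ sqrtD

  record NormalizedMinPoly (α : QF) (f : List ℤ) : Set where
    field
      leading   : Σ (List ℤ) λ g → Σ ℤ λ c → f ≡ g ∷ʳ c × c ≢ 0ℤ
      vanishes  : eval (map ℤ→ℚ f) α ≡ zeroQF
      minimal   : ∀ (h : List ℚ) → length h ℕ.< length f →
                  eval h α ≡ zeroQF → All (_≡ 0ℚ) h
      isPrimitive : foldr (λ c g → gcd ∣ c ∣ g) 0 f ≡ 1

heightPoly : List ℤ → ℕ
heightPoly f = foldr (λ c m → ∣ c ∣ ⊔ m) 0 f

HasHeight : ℕ → QF → ℕ → Set
HasHeight D α n = Σ (List ℤ) λ f → NormalizedMinPoly D α f × heightPoly f ≡ n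

{-# OPTIONS --safe #-}
-- Since (D/p) = 1 there is 0 < x < p with p ∣ x² − D. As p is odd, one of x and p − x
-- is a y with y ≡ D (mod 2); then y² ≡ D (mod 4) because D ≡ 0, 1 (mod 4), so
-- y² − D = 4pc for an integer c, and |c| ≤ p because y < p and D ≤ 4p². The root
-- α = (−y + √D)/(2p) of px² + yx + c generates Q(√D), and this polynomial is its
-- normalized minimal polynomial because α ∉ Q and gcd(y, p) = 1. Hence H(α) = p.
module Submission where

open import Defs

module Residues where
  open import Data.Bool using (true; false; T)
  open import Data.Bool.ListAction using (any)
  open import Data.Integer as ℤ using (ℤ; +_; -[1+_]; _+_; _-_; _*_; -_; 1ℤ; _≤_)
  open import Data.Integer.DivMod using (a≡a%ℕn+[a/ℕn]*n; n%d<d)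
  open import Data.Integer.Divisibility.Signed
    using (_∣_; module _∣_; divides; ∣-refl; ∣ᵤ⇒∣; ∣⇒∣ᵤ; ∣m∣n⇒∣m+n; ∣m∣n⇒∣m-n; ∣n⇒∣m*n; ∣m⇒∣m*n)
  import Data.Integer.Coprimality as ℤ
  import Data.Integer.Properties as ℤ
  open import Data.Integer.Tactic.RingSolver using (solve-∀)
  open import Data.List using (upTo)
  open import Data.List.Membership.Propositional using (find)
  open import Data.List.Membership.Propositional.Properties using (∈-upTo⁻)
  open import Data.List.Relation.Unary.Any.Properties using (any⁻)
  open import Data.Nat as ℕ using (ℕ; suc; NonZero; _%_; _/_)
  open import Data.Nat.Coprimality using (Coprime; prime⇒coprime)
  open import Data.Nat.Primality using (Prime; prime⇒nonTrivial)
  import Data.Nat.Properties as ℕ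
  open import Data.Product using (∃-syntax; _×_; _,_)
  open import Data.Sum using (_⊎_; inj₁; inj₂)
  open import Function using (_∘_)
  open import Relation.Binary.PropositionalEquality
    using (_≡_; _≢_; refl; sym; trans; cong; cong₂; subst; module ≡-Reasoning)

  m%n≡o%n⇒n∣m-o : ∀ (m o n : ℕ) .{{_ : NonZero n}} → m % n ≡ o % n → + n ∣ + m - + o
  m%n≡o%n⇒n∣m-o m o n m%n≡o%n = divides (+ (m / n) - + (o / n)) (begin
    + m - + o
      ≡⟨ cong₂ _-_ (a≡a%ℕn+[a/ℕn]*n (+ m) n) (a≡a%ℕn+[a/ℕn]*n (+ o) n) ⟩
    (+ (m % n) + + (m / n) * + n) - (+ (o % n) + + (o / n) * + n)
      ≡⟨ cong (λ r → (+ (m % n) + + (m / n) * + n) - (+ r + + (o / n) * + n)) (sym m%n≡o%n) ⟩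
    (+ (m % n) + + (m / n) * + n) - (+ (m % n) + + (o / n) * + n)
      ≡⟨ cancel (+ (m % n)) (+ (m / n)) (+ (o / n)) (+ n) ⟩
    (+ (m / n) - + (o / n)) * + n ∎)
    where
    open ≡-Reasoning
    cancel : ∀ r a b n → (r + a * n) - (r + b * n) ≡ (a - b) * n
    cancel = solve-∀

  legendre≡1⇒root : ∀ (D k : ℕ) → legendre D (suc k) ≡ 1ℤ →
                    ∃[ x ] 0 ℕ.< x × x ℕ.< suc k × + suc k ∣ + x * + x - + D
  legendre≡1⇒root D k legendre≡1
    with D % suc k ℕ.≡ᵇ 0 in D%p≢ᵇ0
       | any (λ x → (x ℕ.* x) % suc k ℕ.≡ᵇ D % suc k) (upTo (suc k)) in found
  legendre≡1⇒root D k () | true | _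
  legendre≡1⇒root D k () | false | false
  legendre≡1⇒root D k refl | false | true
    with x , x∈ , x²≡ᵇD ← find (any⁻ _ (upTo (suc k)) (subst T (sym found) _))
    = x , ℕ.n≢0⇒n>0 x≢0 , ∈-upTo⁻ x∈ ,
      subst (λ z → + suc k ∣ z - + D) (ℤ.pos-* x x) (m%n≡o%n⇒n∣m-o (x ℕ.* x) D (suc k) x²≡D)
    where
    x²≡D : (x ℕ.* x) % suc k ≡ D % suc k
    x²≡D = ℕ.≡ᵇ⇒≡ _ _ x²≡ᵇD
    D%p≢0 : D % suc k ≢ 0
    D%p≢0 D%p≡0 with () ← trans (sym D%p≢ᵇ0) (cong (ℕ._≡ᵇ 0) D%p≡0)
    x≢0 : x ≢ 0
    x≢0 x≡0 = D%p≢0 (trans (sym x²≡D) (cong (λ x → (x ℕ.* x) % suc k) x≡0))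

  2∣i⊎2∣i+1 : ∀ (i : ℤ) → + 2 ∣ i ⊎ + 2 ∣ i + 1ℤ
  2∣i⊎2∣i+1 i with i ℤ.%ℕ 2 | a≡a%ℕn+[a/ℕn]*n i 2 | n%d<d i (+ 2)
  ... | 0 | i≡ | _ = inj₁ (divides (i ℤ./ℕ 2) (trans i≡ (ℤ.+-identityˡ _)))
  ... | 1 | i≡ | _ = inj₂ (divides (i ℤ./ℕ 2 + 1ℤ) (trans (cong (_+ 1ℤ) i≡) (shift (i ℤ./ℕ 2))))
    where
    shift : ∀ q → (1ℤ + q * + 2) + 1ℤ ≡ (q + 1ℤ) * + 2
    shift = solve-∀
  ... | suc (suc _) | _ | ℕ.s≤s (ℕ.s≤s ())

  ∣x²-d⇒∣[n-x]²-d : ∀ {n x d : ℤ} → n ∣ x * x - d → n ∣ (n - x) * (n - x) - d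
  ∣x²-d⇒∣[n-x]²-d {n} {x} {d} n∣x²-d =
    subst (n ∣_) (expand n x d) (∣m∣n⇒∣m+n n∣x²-d (∣m⇒∣m*n (n - x - x) ∣-refl))
    where
    expand : ∀ n x d → (x * x - d) + n * (n - x - x) ≡ (n - x) * (n - x) - d
    expand = solve-∀

  2∣[n-x]-d : ∀ {n x d : ℤ} → + 2 ∣ n - 1ℤ → + 2 ∣ (x - d) + 1ℤ → + 2 ∣ (n - x) - d
  2∣[n-x]-d {n} {x} {d} 2∣n-1 2∣x-d+1 =
    subst (+ 2 ∣_) (expand n x d) (∣m∣n⇒∣m-n (∣m∣n⇒∣m+n 2∣n-1 2∣x-d+1) (∣n⇒∣m*n x ∣-refl))
    where
    expand : ∀ n x d → ((n - 1ℤ) + ((x - d) + 1ℤ)) - x * + 2 ≡ (n - x) - d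
    expand = solve-∀

  same-parity-root : ∀ {p x D : ℕ} → 0 ℕ.< x → x ℕ.< p →
                     + 2 ∣ + p - 1ℤ → + p ∣ + x * + x - + D →
                     ∃[ y ] 0 ℕ.< y × y ℕ.< p × + p ∣ + y * + y - + D × + 2 ∣ + y - + D
  same-parity-root {p} {x} {D} 0<x x<p 2∣p-1 p∣x²-D with 2∣i⊎2∣i+1 (+ x - + D)
  ... | inj₁ 2∣x-D   = x , 0<x , x<p , p∣x²-D , 2∣x-D
  ... | inj₂ 2∣x-D+1 = p ℕ.∸ x , ℕ.m<n⇒0<n∸m x<p , ℕ.∸-monoʳ-< 0<x (ℕ.<⇒≤ x<p) ,
    subst (λ y → + p ∣ y * y - + D) p-x≡p∸x (∣x²-d⇒∣[n-x]²-d {+ p} {+ x} {+ D} p∣x²-D) ,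
    subst (λ y → + 2 ∣ y - + D) p-x≡p∸x (2∣[n-x]-d {+ p} {+ x} {+ D} 2∣p-1 2∣x-D+1)
    where
    p-x≡p∸x : + p - + x ≡ + (p ℕ.∸ x)
    p-x≡p∸x = trans (ℤ.m-n≡m⊖n p x) (ℤ.⊖-≥ (ℕ.<⇒≤ x<p))

  realQuadDisc⇒4∣D[D-1] : ∀ {D : ℕ} → IsRealQuadDisc D → + 4 ∣ + D * (+ D - 1ℤ)
  realQuadDisc⇒4∣D[D-1] {D} (_ , inj₁ (D%4≡1 , _)) = ∣n⇒∣m*n (+ D) (m%n≡o%n⇒n∣m-o D 1 4 D%4≡1)
  realQuadDisc⇒4∣D[D-1] (_ , inj₂ (m , refl , _)) =
    ∣m⇒∣m*n _ (divides (+ m) (trans (cong +_ (ℕ.*-comm 4 m)) (ℤ.pos-* m 4)))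

  4∣y²-d : ∀ {y d : ℤ} → + 2 ∣ y - d → + 4 ∣ d * (d - 1ℤ) → + 4 ∣ y * y - d
  4∣y²-d {y} {d} (divides t y-d≡2t) (divides q d[d-1]≡4q) = divides (t * (d + t) + q) (begin
    y * y - d                             ≡⟨ cong (λ z → z * z - d) y≡ ⟩
    (t * + 2 + d) * (t * + 2 + d) - d     ≡⟨ expand t d ⟩
    t * (d + t) * + 4 + d * (d - 1ℤ)      ≡⟨ cong (λ z → t * (d + t) * + 4 + z) d[d-1]≡4q ⟩
    t * (d + t) * + 4 + q * + 4           ≡⟨ ℤ.*-distribʳ-+ (+ 4) (t * (d + t)) q ⟨
    (t * (d + t) + q) * + 4               ∎)
    where
    open ≡-Reasoning
    sub-add : ∀ y d → y ≡ (y - d) + d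
    sub-add = solve-∀
    y≡ : y ≡ t * + 2 + d
    y≡ = trans (sub-add y d) (cong (_+ d) y-d≡2t)
    expand : ∀ t d → (t * + 2 + d) * (t * + 2 + d) - d ≡ t * (d + t) * + 4 + d * (d - 1ℤ)
    expand = solve-∀

  coprime-divisor : ∀ {i j k : ℤ} → Coprime (ℤ.∣ i ∣) (ℤ.∣ j ∣) → i ∣ j * k → i ∣ k
  coprime-divisor {i} {j} {k} i⊥j = ∣ᵤ⇒∣ ∘ ℤ.coprime-divisor i j k i⊥j ∘ ∣⇒∣ᵤ

  odd-prime⇒coprime-2 : ∀ {p : ℕ} → Prime p → p % 2 ≡ 1 → Coprime p 2
  odd-prime⇒coprime-2 {p} p-prime p-odd =
    prime⇒coprime p-prime (ℕ.≤∧≢⇒< (ℕ.nonTrivial⇒n>1 p {{prime⇒nonTrivial p-prime}}) 2≢p)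
    where
    2≢p : 2 ≢ p
    2≢p 2≡p with () ← trans (cong (_% 2) 2≡p) p-odd

  4∣∧p∣⇒4p∣ : ∀ {p : ℕ} {z : ℤ} → Coprime p 2 → + 4 ∣ z → + p ∣ z → + 4 * + p ∣ z
  4∣∧p∣⇒4p∣ {p} p⊥2 (divides q refl) p∣4q = divides r (begin
    q * + 4              ≡⟨ cong (_* + 4) q≡rp ⟩
    r * + p * + 4        ≡⟨ regroup r (+ p) ⟩
    r * (+ 4 * + p)      ∎)
    where
    open ≡-Reasoning
    split-4 : ∀ q → q * + 4 ≡ + 2 * (+ 2 * q)
    split-4 = solve-∀
    regroup : ∀ r p → r * p * + 4 ≡ r * (+ 4 * p)
    regroup = solve-∀
    p∣q : + p ∣ q
    p∣q = coprime-divisor {j = + 2} p⊥2 (coprime-divisor {j = + 2} p⊥2 (subst (+ p ∣_) (split-4 q) p∣4q))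
    open _∣_ p∣q
      renaming (quotient to r; equality to q≡rp)

  -n≤i≤n⇒∣i∣≤n : ∀ {i : ℤ} {n : ℕ} → - + n ≤ i → i ≤ + n → ℤ.∣ i ∣ ℕ.≤ n
  -n≤i≤n⇒∣i∣≤n {+ _} _ i≤n = ℤ.drop‿+≤+ i≤n
  -n≤i≤n⇒∣i∣≤n { -[1+ _ ]} -n≤i _ = ℤ.drop‿+≤+ (ℤ.neg-cancel-≤ -n≤i)

  quotient-bound : ∀ {y D : ℕ} {c : ℤ} p .{{_ : NonZero p}} → y ℕ.≤ p → D ℕ.≤ 4 ℕ.* (p ℕ.* p) →
                   + y * + y - + D ≡ c * (+ 4 * + p) → ℤ.∣ c ∣ ℕ.≤ p
  quotient-bound {y} {D} {c} p@(suc _) y≤p D≤4p² y²-D≡4pc = -n≤i≤n⇒∣i∣≤n -p≤c c≤p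
    where
    open ℤ.≤-Reasoning
    +y² : + (y ℕ.* y) ≡ + y * + y
    +y² = ℤ.pos-* y y
    regroup : ∀ p → + 4 * (p * p) ≡ p * (+ 4 * p)
    regroup = solve-∀
    +4p² : + (4 ℕ.* (p ℕ.* p)) ≡ + p * (+ 4 * + p)
    +4p² = trans (trans (ℤ.pos-* 4 (p ℕ.* p)) (cong (+ 4 *_) (ℤ.pos-* p p))) (regroup (+ p))
    c≤p : c ≤ + p
    c≤p = ℤ.*-cancelʳ-≤-pos c (+ p) (+ 4 * + p) (begin
      c * (+ 4 * + p)          ≡⟨ y²-D≡4pc ⟨
      + y * + y - + D          ≤⟨ ℤ.i-j≤i (+ y * + y) (+ D) ⟩
      + y * + y                ≡⟨ +y² ⟨
      + (y ℕ.* y)              ≤⟨ ℤ.+≤+ (ℕ.≤-trans (ℕ.*-mono-≤ y≤p y≤p) (ℕ.m≤n*m (p ℕ.* p) 4)) ⟩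
      + (4 ℕ.* (p ℕ.* p))      ≡⟨ +4p² ⟩
      + p * (+ 4 * + p)        ∎)
    -p≤c : - + p ≤ c
    -p≤c = ℤ.*-cancelʳ-≤-pos (- + p) c (+ 4 * + p) (begin
      - + p * (+ 4 * + p)      ≡⟨ ℤ.neg-distribˡ-* (+ p) _ ⟨
      - (+ p * (+ 4 * + p))    ≡⟨ cong -_ +4p² ⟨
      - + (4 ℕ.* (p ℕ.* p))    ≤⟨ ℤ.neg-mono-≤ (ℤ.+≤+ D≤4p²) ⟩
      - + D                    ≤⟨ ℤ.i≤j+i (- + D) (+ (y ℕ.* y)) ⟩
      + (y ℕ.* y) - + D        ≡⟨ cong (_- + D) +y² ⟩
      + y * + y - + D          ≡⟨ y²-D≡4pc ⟩
      c * (+ 4 * + p)          ∎)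

  small-quadratic-of-discriminant :
    ∀ {D p : ℕ} → IsRealQuadDisc D → Prime p → p % 2 ≡ 1 → legendre D p ≡ 1ℤ → D ℕ.≤ 4 ℕ.* (p ℕ.* p) →
    ∃[ y ] ∃[ c ] 0 ℕ.< y × y ℕ.< p × ℤ.∣ c ∣ ℕ.≤ p × + y * + y ≡ (+ p + + p) * (c + c) + + D
  small-quadratic-of-discriminant {D} {p@(suc k)} disc p-prime p-odd legendre≡1 D≤4p²
    with x , 0<x , x<p , p∣x²-D ← legendre≡1⇒root D k legendre≡1
    with y , 0<y , y<p , p∣y²-D , 2∣y-D ← same-parity-root 0<x x<p (m%n≡o%n⇒n∣m-o p 1 2 p-odd) p∣x²-D
    = y , c , 0<y , y<p , quotient-bound {y} {D} {c} p (ℕ.<⇒≤ y<p) D≤4p² y²-D≡c4p , discriminant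
    where
    4p∣y²-D : + 4 * + p ∣ + y * + y - + D
    4p∣y²-D = 4∣∧p∣⇒4p∣ (odd-prime⇒coprime-2 p-prime p-odd)
                        (4∣y²-d {+ y} {+ D} 2∣y-D (realQuadDisc⇒4∣D[D-1] disc)) p∣y²-D
    open _∣_ 4p∣y²-D renaming (quotient to c; equality to y²-D≡c4p)
    open ≡-Reasoning
    sub-add : ∀ a d → a ≡ (a - d) + d
    sub-add = solve-∀
    regroup : ∀ c p d → c * (+ 4 * p) + d ≡ (p + p) * (c + c) + d
    regroup = solve-∀
    discriminant : + y * + y ≡ (+ p + + p) * (c + c) + + D
    discriminant = begin
      + y * + y                     ≡⟨ sub-add (+ y * + y) (+ D) ⟩
      (+ y * + y - + D) + + D       ≡⟨ cong (_+ + D) y²-D≡c4p ⟩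
      c * (+ 4 * + p) + + D         ≡⟨ regroup c (+ p) (+ D) ⟩
      (+ p + + p) * (c + c) + + D   ∎

open import Data.Nat using (ℕ; _%_) renaming (_*_ to _*ℕ_; _≤_ to _≤ℕ_)
open import Data.Nat.Primality using (Prime)
open import Data.Integer using (1ℤ)
open import Data.Rational using (ℚ; 0ℚ; ½; _+_; _*_; _≤_; _<_)
open import Data.Product using (Σ; _×_)
open import Relation.Binary.PropositionalEquality using (_≡_)

open import Data.Integer as ℤ using (ℤ; +_; 0ℤ)
import Data.Integer.GCD as ℤ
import Data.Integer.Properties as ℤ
import Data.Integer.Tactic.RingSolver as ℤ-Solver
open import Data.List using ([]; _∷_; length; foldr)
open import Data.List.Relation.Unary.All using (All; []; _∷_)
import Data.Nat as ℕ
open import Data.Nat.Coprimality using (coprime⇒gcd≡1; prime⇒coprime)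
import Data.Nat.Coprimality as Coprime
open import Data.Nat.GCD using (gcd; gcd-identityʳ; gcd-zeroʳ)
open import Data.Nat.Primality using (prime⇒nonZero)
import Data.Nat.Properties as ℕ
open import Data.Product using (∃-syntax; _,_)
open import Data.Rational using (1ℚ; -_; _-_; 1/_; ↥_; ≢-nonZero; toℚᵘ)
open import Data.Rational.Properties
  using (+-*-commutativeRing; _≟_; 1≢0; *-zeroˡ; *-inverseˡ; *-inverseʳ; *-identityʳ; *-assoc; *-comm;
         ↥-/; p≡0⇒↥p≡0; toℚᵘ-injective; toℚᵘ-fromℚᵘ; toℚᵘ-homo-+; toℚᵘ-homo-*)
open import Data.Rational.Unnormalised as ℚᵘ using (mkℚᵘ; *≡*)
import Data.Rational.Unnormalised.Properties as ℚᵘ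
open import Function using (_∘_)
open import Level using (0ℓ)
open import Relation.Binary.PropositionalEquality using (_≢_; refl; sym; trans; cong; cong₂; subst; module ≡-Reasoning)
open import Relation.Nullary.Decidable using (dec⇒maybe)
open import Tactic.RingSolver using (solve-∀)
open import Tactic.RingSolver.Core.AlmostCommutativeRing using (AlmostCommutativeRing; fromCommutativeRing)

open Residues using (small-quadratic-of-discriminant)

ℚ-ring : AlmostCommutativeRing 0ℓ 0ℓ
ℚ-ring = fromCommutativeRing +-*-commutativeRing (λ x → dec⇒maybe (0ℚ ≟ x))

eval-∷ : ∀ D c cs u v {r i} → eval D cs (u + v √D) ≡ r + i √D →
         eval D (c ∷ cs) (u + v √D) ≡ (c + (u * r + ℕ→ℚ D * (v * i))) + (0ℚ + (u * i + v * r)) √D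
eval-∷ D c cs u v = cong (λ e → addQF D (scalar D c) (mulQF D (u + v √D) e))

eval-constant : ∀ D c₀ u v → eval D (c₀ ∷ []) (u + v √D) ≡ c₀ + 0ℚ √D
eval-constant D c₀ u v = trans (eval-∷ D c₀ [] u v refl) (cong₂ _+_√D (re c₀ u v (ℕ→ℚ D)) (im u v))
  where
  re : ∀ c₀ u v d → c₀ + (u * 0ℚ + d * (v * 0ℚ)) ≡ c₀
  re = solve-∀ ℚ-ring
  im : ∀ u v → 0ℚ + (u * 0ℚ + v * 0ℚ) ≡ 0ℚ
  im = solve-∀ ℚ-ring

eval-linear : ∀ D c₀ c₁ u v → eval D (c₀ ∷ c₁ ∷ []) (u + v √D) ≡ (c₀ + c₁ * u) + (c₁ * v) √D
eval-linear D c₀ c₁ u v =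
  trans (eval-∷ D c₀ (c₁ ∷ []) u v (eval-constant D c₁ u v)) (cong₂ _+_√D (re c₀ c₁ u v (ℕ→ℚ D)) (im c₁ u v))
  where
  re : ∀ c₀ c₁ u v d → c₀ + (u * c₁ + d * (v * 0ℚ)) ≡ c₀ + c₁ * u
  re = solve-∀ ℚ-ring
  im : ∀ c₁ u v → 0ℚ + (u * 0ℚ + v * c₁) ≡ c₁ * v
  im = solve-∀ ℚ-ring

eval-quadratic : ∀ D c₀ c₁ c₂ u v → eval D (c₀ ∷ c₁ ∷ c₂ ∷ []) (u + v √D) ≡
                 (c₀ + c₁ * u + c₂ * (u * u + ℕ→ℚ D * (v * v))) + (c₁ * v + (c₂ + c₂) * (u * v)) √D
eval-quadratic D c₀ c₁ c₂ u v =
  trans (eval-∷ D c₀ (c₁ ∷ c₂ ∷ []) u v (eval-linear D c₁ c₂ u v))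
        (cong₂ _+_√D (re c₀ c₁ c₂ u v (ℕ→ℚ D)) (im c₁ c₂ u v))
  where
  re : ∀ c₀ c₁ c₂ u v d → c₀ + (u * (c₁ + c₂ * u) + d * (v * (c₂ * v))) ≡ c₀ + c₁ * u + c₂ * (u * u + d * (v * v))
  re = solve-∀ ℚ-ring
  im : ∀ c₁ c₂ u v → 0ℚ + (u * (c₂ * v) + v * (c₁ + c₂ * u)) ≡ c₁ * v + (c₂ + c₂) * (u * v)
  im = solve-∀ ℚ-ring

x*y≡0⇒x≡0 : ∀ {x y} → y ≢ 0ℚ → x * y ≡ 0ℚ → x ≡ 0ℚ
x*y≡0⇒x≡0 {x} {y} y≢0 xy≡0 = begin
  x                ≡⟨ *-identityʳ x ⟨
  x * 1ℚ           ≡⟨ cong (x *_) (*-inverseʳ y) ⟨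
  x * (y * 1/ y)   ≡⟨ *-assoc x y (1/ y) ⟨
  x * y * 1/ y     ≡⟨ cong (_* 1/ y) xy≡0 ⟩
  0ℚ * 1/ y        ≡⟨ *-zeroˡ (1/ y) ⟩
  0ℚ               ∎
  where
  open ≡-Reasoning
  instance _ = ≢-nonZero y≢0

im≢0⇒minimal : ∀ D {α} → QF.im α ≢ 0ℚ →
               ∀ h → length h ℕ.< 3 → eval D h α ≡ zeroQF D → All (_≡ 0ℚ) h
im≢0⇒minimal D v≢0 [] _ _ = []
im≢0⇒minimal D {u + v √D} v≢0 (c₀ ∷ []) _ eq = cong QF.re (trans (sym (eval-constant D c₀ u v)) eq) ∷ []
im≢0⇒minimal D {u + v √D} v≢0 (c₀ ∷ c₁ ∷ []) _ eq = c₀≡0 ∷ c₁≡0 ∷ []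
  where
  eq′ : (c₀ + c₁ * u) + (c₁ * v) √D ≡ zeroQF D
  eq′ = trans (sym (eval-linear D c₀ c₁ u v)) eq
  c₁≡0 : c₁ ≡ 0ℚ
  c₁≡0 = x*y≡0⇒x≡0 v≢0 (cong QF.im eq′)
  c₀+0u≡c₀ : ∀ c₀ u → c₀ + 0ℚ * u ≡ c₀
  c₀+0u≡c₀ = solve-∀ ℚ-ring
  c₀≡0 : c₀ ≡ 0ℚ
  c₀≡0 = trans (sym (c₀+0u≡c₀ c₀ u)) (subst (λ t → c₀ + t * u ≡ 0ℚ) c₁≡0 (cong QF.re eq′))
im≢0⇒minimal D v≢0 (_ ∷ _ ∷ _ ∷ _) (ℕ.s≤s (ℕ.s≤s (ℕ.s≤s ()))) _

module QuadraticRoot (D : ℕ) {a b w : ℚ} (w*2a≡1 : w * (a + a) ≡ 1ℚ) where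

  open ≡-Reasoning

  root : QF
  root = (- (b * w)) + w √D

  root-irrational : QF.im root ≢ 0ℚ
  root-irrational w≡0 = 1≢0 (begin
    1ℚ            ≡⟨ w*2a≡1 ⟨
    w * (a + a)   ≡⟨ cong (_* (a + a)) w≡0 ⟩
    0ℚ * (a + a)  ≡⟨ *-zeroˡ (a + a) ⟩
    0ℚ            ∎)

  root-generates : eval D (b ∷ (a + a) ∷ []) root ≡ sqrtD D
  root-generates = trans (eval-linear D b (a + a) (- (b * w)) w) (cong₂ _+_√D re im)
    where
    factor : ∀ a b w → b + (a + a) * (- (b * w)) ≡ b * (1ℚ - w * (a + a))
    factor = solve-∀ ℚ-ring
    cancel : ∀ b → b * (1ℚ - 1ℚ) ≡ 0ℚ
    cancel = solve-∀ ℚ-ring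
    re : b + (a + a) * (- (b * w)) ≡ 0ℚ
    re = begin
      b + (a + a) * (- (b * w))   ≡⟨ factor a b w ⟩
      b * (1ℚ - w * (a + a))      ≡⟨ cong (λ t → b * (1ℚ - t)) w*2a≡1 ⟩
      b * (1ℚ - 1ℚ)               ≡⟨ cancel b ⟩
      0ℚ                          ∎
    im : (a + a) * w ≡ 1ℚ
    im = trans (*-comm (a + a) w) w*2a≡1

  root-vanishes : ∀ c → b * b ≡ (a + a) * (c + c) + ℕ→ℚ D → eval D (c ∷ b ∷ a ∷ []) root ≡ zeroQF D
  root-vanishes c disc = trans (eval-quadratic D c b a (- (b * w)) w) (cong₂ _+_√D re im)
    where
    d = ℕ→ℚ D
    u = - (b * w)
    factor-re : ∀ a b c w d →
      c + b * (- (b * w)) + a * ((- (b * w)) * (- (b * w)) + d * (w * w)) ≡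
      (w * (a + a) - 1ℚ) * (b * b * w - c * (w * (a + a) + 1ℚ)) - a * (w * w) * (b * b - ((a + a) * (c + c) + d))
    factor-re = solve-∀ ℚ-ring
    cancel-re : ∀ a b c w → (1ℚ - 1ℚ) * (b * b * w - c * (1ℚ + 1ℚ)) - a * (w * w) * (b * b - b * b) ≡ 0ℚ
    cancel-re = solve-∀ ℚ-ring
    factor-im : ∀ a b w → b * w + (a + a) * ((- (b * w)) * w) ≡ - (b * w) * (w * (a + a) - 1ℚ)
    factor-im = solve-∀ ℚ-ring
    cancel-im : ∀ b w → - (b * w) * (1ℚ - 1ℚ) ≡ 0ℚ
    cancel-im = solve-∀ ℚ-ring
    re : c + b * u + a * (u * u + d * (w * w)) ≡ 0ℚ
    re = begin
      c + b * u + a * (u * u + d * (w * w))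
        ≡⟨ factor-re a b c w d ⟩
      (w * (a + a) - 1ℚ) * (b * b * w - c * (w * (a + a) + 1ℚ)) - a * (w * w) * (b * b - ((a + a) * (c + c) + d))
        ≡⟨ cong₂ (λ t s → (t - 1ℚ) * (b * b * w - c * (t + 1ℚ)) - a * (w * w) * (b * b - s)) w*2a≡1 (sym disc) ⟩
      (1ℚ - 1ℚ) * (b * b * w - c * (1ℚ + 1ℚ)) - a * (w * w) * (b * b - b * b)
        ≡⟨ cancel-re a b c w ⟩
      0ℚ ∎
    im : b * w + (a + a) * (u * w) ≡ 0ℚ
    im = begin
      b * w + (a + a) * (u * w)   ≡⟨ factor-im a b w ⟩
      u * (w * (a + a) - 1ℚ)      ≡⟨ cong (λ t → u * (t - 1ℚ)) w*2a≡1 ⟩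
      u * (1ℚ - 1ℚ)               ≡⟨ cancel-im b w ⟩
      0ℚ                          ∎

-- ℤ→ℚ i = i / 1 is definitionally fromℚᵘ (mkℚᵘ i 0).
ℤ→ℚ-toℚᵘ : ∀ i → toℚᵘ (ℤ→ℚ i) ℚᵘ.≃ mkℚᵘ i 0
ℤ→ℚ-toℚᵘ i = toℚᵘ-fromℚᵘ (mkℚᵘ i 0)

ℤ→ℚ-+ : ∀ i j → ℤ→ℚ (i ℤ.+ j) ≡ ℤ→ℚ i + ℤ→ℚ j
ℤ→ℚ-+ i j = toℚᵘ-injective (begin
  toℚᵘ (ℤ→ℚ (i ℤ.+ j))               ≈⟨ ℤ→ℚ-toℚᵘ (i ℤ.+ j) ⟩
  mkℚᵘ (i ℤ.+ j) 0                    ≈⟨ *≡* (over-1 i j) ⟩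
  mkℚᵘ i 0 ℚᵘ.+ mkℚᵘ j 0              ≈⟨ ℚᵘ.+-cong (ℤ→ℚ-toℚᵘ i) (ℤ→ℚ-toℚᵘ j) ⟨
  toℚᵘ (ℤ→ℚ i) ℚᵘ.+ toℚᵘ (ℤ→ℚ j)      ≈⟨ toℚᵘ-homo-+ (ℤ→ℚ i) (ℤ→ℚ j) ⟨
  toℚᵘ (ℤ→ℚ i + ℤ→ℚ j)               ∎)
  where
  open ℚᵘ.≃-Reasoning
  over-1 : ∀ i j → (i ℤ.+ j) ℤ.* + 1 ≡ (i ℤ.* + 1 ℤ.+ j ℤ.* + 1) ℤ.* + 1
  over-1 = ℤ-Solver.solve-∀

ℤ→ℚ-* : ∀ i j → ℤ→ℚ (i ℤ.* j) ≡ ℤ→ℚ i * ℤ→ℚ j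
ℤ→ℚ-* i j = toℚᵘ-injective (begin
  toℚᵘ (ℤ→ℚ (i ℤ.* j))               ≈⟨ ℤ→ℚ-toℚᵘ (i ℤ.* j) ⟩
  mkℚᵘ (i ℤ.* j) 0                    ≈⟨ *≡* refl ⟩
  mkℚᵘ i 0 ℚᵘ.* mkℚᵘ j 0              ≈⟨ ℚᵘ.*-cong (ℤ→ℚ-toℚᵘ i) (ℤ→ℚ-toℚᵘ j) ⟨
  toℚᵘ (ℤ→ℚ i) ℚᵘ.* toℚᵘ (ℤ→ℚ j)      ≈⟨ toℚᵘ-homo-* (ℤ→ℚ i) (ℤ→ℚ j) ⟨
  toℚᵘ (ℤ→ℚ i * ℤ→ℚ j)               ∎)
  where open ℚᵘ.≃-Reasoning

ℤ→ℚ≡0⇒≡0 : ∀ {i} → ℤ→ℚ i ≡ 0ℚ → i ≡ 0ℤ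
ℤ→ℚ≡0⇒≡0 {i} i≡0 = begin
  i                              ≡⟨ ↥-/ i 1 ⟨
  ↥ (ℤ→ℚ i) ℤ.* gcd′             ≡⟨ cong (ℤ._* gcd′) (p≡0⇒↥p≡0 (ℤ→ℚ i) i≡0) ⟩
  0ℤ ℤ.* gcd′                    ≡⟨ ℤ.*-zeroˡ gcd′ ⟩
  0ℤ                             ∎
  where
  open ≡-Reasoning
  gcd′ = ℤ.gcd i (+ 1)

i+i≡0⇒i≡0 : ∀ {i} → i ℤ.+ i ≡ 0ℤ → i ≡ 0ℤ
i+i≡0⇒i≡0 {i} i+i≡0 = ℤ.*-cancelˡ-≡ (+ 2) i 0ℤ (trans (double i) i+i≡0)
  where
  double : ∀ i → + 2 ℤ.* i ≡ i ℤ.+ i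
  double = ℤ-Solver.solve-∀

quadratic-minimal-polynomial :
  ∀ D {a b c : ℤ} → a ≢ 0ℤ → b ℤ.* b ≡ (a ℤ.+ a) ℤ.* (c ℤ.+ c) ℤ.+ + D →
  foldr (λ c g → gcd ℤ.∣ c ∣ g) 0 (c ∷ b ∷ a ∷ []) ≡ 1 →
  ∃[ α ] Generates D α × NormalizedMinPoly D α (c ∷ b ∷ a ∷ [])
quadratic-minimal-polynomial D {a} {b} {c} a≢0 disc gcd≡1 =
  root , (B ∷ A + A ∷ [] , root-generates) , record
    { leading     = c ∷ b ∷ [] , a , refl , a≢0
    ; vanishes    = root-vanishes C disc-ℚ
    ; minimal     = im≢0⇒minimal D root-irrational
    ; isPrimitive = gcd≡1
    }
  where
  A = ℤ→ℚ a
  B = ℤ→ℚ b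
  C = ℤ→ℚ c
  2A≢0 : A + A ≢ 0ℚ
  2A≢0 = a≢0 ∘ i+i≡0⇒i≡0 ∘ ℤ→ℚ≡0⇒≡0 ∘ trans (ℤ→ℚ-+ a a)
  instance _ = ≢-nonZero 2A≢0
  open QuadraticRoot D {A} {B} {1/ (A + A)} (*-inverseˡ (A + A))
  disc-ℚ : B * B ≡ (A + A) * (C + C) + ℕ→ℚ D
  disc-ℚ = begin
    B * B                                      ≡⟨ ℤ→ℚ-* b b ⟨
    ℤ→ℚ (b ℤ.* b)                              ≡⟨ cong ℤ→ℚ disc ⟩
    ℤ→ℚ ((a ℤ.+ a) ℤ.* (c ℤ.+ c) ℤ.+ + D)      ≡⟨ ℤ→ℚ-+ ((a ℤ.+ a) ℤ.* (c ℤ.+ c)) (+ D) ⟩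
    ℤ→ℚ ((a ℤ.+ a) ℤ.* (c ℤ.+ c)) + ℕ→ℚ D      ≡⟨ cong (_+ ℕ→ℚ D) (ℤ→ℚ-* (a ℤ.+ a) (c ℤ.+ c)) ⟩
    ℤ→ℚ (a ℤ.+ a) * ℤ→ℚ (c ℤ.+ c) + ℕ→ℚ D      ≡⟨ cong₂ (λ x y → x * y + ℕ→ℚ D) (ℤ→ℚ-+ a a) (ℤ→ℚ-+ c c) ⟩
    (A + A) * (C + C) + ℕ→ℚ D                  ∎
    where open ≡-Reasoning

coprime⇒primitive : ∀ {a b c : ℤ} → gcd ℤ.∣ b ∣ ℤ.∣ a ∣ ≡ 1 →
                    foldr (λ c g → gcd ℤ.∣ c ∣ g) 0 (c ∷ b ∷ a ∷ []) ≡ 1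
coprime⇒primitive {a} {b} {c} b⊥a = begin
  gcd ℤ.∣ c ∣ (gcd ℤ.∣ b ∣ (gcd ℤ.∣ a ∣ 0))   ≡⟨ cong (λ g → gcd ℤ.∣ c ∣ (gcd ℤ.∣ b ∣ g)) (gcd-identityʳ ℤ.∣ a ∣) ⟩
  gcd ℤ.∣ c ∣ (gcd ℤ.∣ b ∣ ℤ.∣ a ∣)           ≡⟨ cong (gcd ℤ.∣ c ∣) b⊥a ⟩
  gcd ℤ.∣ c ∣ 1                                ≡⟨ gcd-zeroʳ ℤ.∣ c ∣ ⟩
  1                                            ∎
  where open ≡-Reasoning

heightPoly-dominated : ∀ {a b c : ℤ} → ℤ.∣ c ∣ ≤ℕ ℤ.∣ a ∣ → ℤ.∣ b ∣ ≤ℕ ℤ.∣ a ∣ →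
                       heightPoly (c ∷ b ∷ a ∷ []) ≡ ℤ.∣ a ∣
heightPoly-dominated {a} {b} {c} c≤a b≤a = begin
  ℤ.∣ c ∣ ℕ.⊔ (ℤ.∣ b ∣ ℕ.⊔ (ℤ.∣ a ∣ ℕ.⊔ 0))   ≡⟨ cong (λ h → ℤ.∣ c ∣ ℕ.⊔ (ℤ.∣ b ∣ ℕ.⊔ h)) (ℕ.⊔-identityʳ ℤ.∣ a ∣) ⟩
  ℤ.∣ c ∣ ℕ.⊔ (ℤ.∣ b ∣ ℕ.⊔ ℤ.∣ a ∣)           ≡⟨ cong (ℤ.∣ c ∣ ℕ.⊔_) (ℕ.m≤n⇒m⊔n≡n b≤a) ⟩
  ℤ.∣ c ∣ ℕ.⊔ ℤ.∣ a ∣                          ≡⟨ ℕ.m≤n⇒m⊔n≡n c≤a ⟩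
  ℤ.∣ a ∣                                      ∎
  where open ≡-Reasoning

lemma2 : (ε : ℚ) → 0ℚ < ε → ε ≤ ½ →
         (D : ℕ) → IsRealQuadDisc D →
         (p : ℕ) → Prime p → p % 2 ≡ 1 → legendre D p ≡ 1ℤ →
         D ≤ℕ 4 *ℕ (p *ℕ p) →
         ℕ→ℚ (p *ℕ p) ≤ ((½ + ε) * (½ + ε)) * ℕ→ℚ D →
         Σ QF λ α → Generates D α × Σ ℕ λ H → HasHeight D α H ×
           ℕ→ℚ (H *ℕ H) ≤ ((½ + ε) * (½ + ε)) * ℕ→ℚ D
lemma2 _ _ _ D disc p p-prime p-odd legendre≡1 D≤4p² p²≤bound
  with y , c , 0<y , y<p , ∣c∣≤p , discriminant ← small-quadratic-of-discriminant disc p-prime p-odd legendre≡1 D≤4p²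
  = let α , generates , minimal-polynomial =
          quadratic-minimal-polynomial D p≢0 discriminant (coprime⇒primitive {+ p} {+ y} {c} y⊥p)
    in α , generates , p , (c ∷ + y ∷ + p ∷ [] , minimal-polynomial , height≡p) , p²≤bound
  where
  p≢0 : + p ≢ 0ℤ
  p≢0 = ℕ.≢-nonZero⁻¹ p {{prime⇒nonZero p-prime}} ∘ ℤ.+-injective
  y⊥p : gcd y p ≡ 1
  y⊥p = coprime⇒gcd≡1 (Coprime.sym (prime⇒coprime p-prime {{ℕ.>-nonZero 0<y}} y<p))
  height≡p : heightPoly (c ∷ + y ∷ + p ∷ []) ≡ p
  height≡p = heightPoly-dominated {+ p} {+ y} {c} ∣c∣≤p (ℕ.<⇒≤ y<p)
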